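{- Let $n \geq 4$ and let $T, T' \in \mathcal{Y}_n$. If the sets of $1$-minors of $T$ and $T'$ are equal, then the entry $n$ occupies the same cell in $T$ as in $T'$. (That is, the set of $1$-minors of a standard Young tableau with $n \geq 4$ entries determines the location of its largest entry.)
   Context: A partition $\lambda$ of $n$ is a non-increasing finite sequence $(\lambda_1,\ldots,\lambda_m)$ of positive integers summing to $n$; its Young diagram is a left-aligned array of cells with $\lambda_h$ cells in row $h$ (rows counted from the top). A standard Young tableau of shape $\lambda$ is a filling of the Young diagram of $\lambda$ with $1,\ldots,n$, each exactly once, increasing left to right along rows and top to bottom down columns; $\mathcal{Y}_n$ denotes the set of standard Young tableaux with $n$ entries. For $T \in \mathcal{Y}_n$ and $m \in \{1,\ldots,n\}$, the tableau $T - m \in \mathcal{Y}_{n-1}$ is obtained as follows: remove the cell containing $m$, leaving a space; repeatedly, let $R$ be the cell immediately right of the space and $B$ the cell immediately below it (if they exist); if $R$ exists and ($B$ does not exist or the entry of $R$ is smaller than that of $B$), slide $R$ into the space; otherwise, if $B$ exists, slide $B$ into the space; if neither exists, stop (jeu de taquin). Finally renumber every entry $p > m$ as $p-1$. The set of $1$-minors of $T$ is $\{T - m : 1 \leq m \leq n\}$. -}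

module Defs where

open import Data.Nat using (ℕ; zero; suc; _+_; _∸_; _≤_; _<_; _<ᵇ_; _≡ᵇ_)
open import Data.Bool using (Bool; true; false; if_then_else_)
open import Data.Maybe using (Maybe; just; nothing)
open import Data.Product using (_×_; _,_; ∃; ∃-syntax)
open import Data.List using (List; []; _∷_; map; length; concat; upTo)
open import Data.Nat.ListAction using (sum)
open import Data.Empty using (⊥)
open import Data.Unit using (⊤)
open import Data.List.Relation.Unary.All using (All)
open import Data.List.Relation.Unary.Linked using (Linked)
open import Data.List.Relation.Binary.Permutation.Propositional using (_↭_)
open import Relation.Binary.PropositionalEquality using (_≡_)
open import Relation.Nullary using (¬_)
open import Function.Bundles using (_⇔_)

-- A tableau is given by its list of rows (top row first); each row is
-- the list of its entries from left to right.  Cells are addressed by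
-- (row index, column index), both 0-based.
Tableau : Set
Tableau = List (List ℕ)

at : List ℕ → ℕ → Maybe ℕ
at []       _       = nothing
at (x ∷ xs) zero    = just x
at (x ∷ xs) (suc i) = at xs i

entry : Tableau → ℕ → ℕ → Maybe ℕ
entry []         _       c = nothing
entry (row ∷ rs) zero    c = at row c
entry (row ∷ rs) (suc r) c = entry rs r c

setAt : List ℕ → ℕ → ℕ → List ℕ
setAt []       _       v = []
setAt (x ∷ xs) zero    v = v ∷ xs
setAt (x ∷ xs) (suc i) v = x ∷ setAt xs i v

setEntry : Tableau → ℕ → ℕ → ℕ → Tableau
setEntry []         _       c v = []
setEntry (row ∷ rs) zero    c v = setAt row c v ∷ rs
setEntry (row ∷ rs) (suc r) c v = row ∷ setEntry rs r c v

dropLastElem : List ℕ → List ℕ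
dropLastElem []           = []
dropLastElem (x ∷ [])     = []
dropLastElem (x ∷ y ∷ xs) = x ∷ dropLastElem (y ∷ xs)

nonEmptyRow : List ℕ → Bool
nonEmptyRow []      = false
nonEmptyRow (_ ∷ _) = true

dropLastOfRow : Tableau → ℕ → Tableau
dropLastOfRow []         _       = []
dropLastOfRow (row ∷ rs) zero    with nonEmptyRow (dropLastElem row)
... | true  = dropLastElem row ∷ rs
... | false = rs
dropLastOfRow (row ∷ rs) (suc r) = row ∷ dropLastOfRow rs r

-- Jeu de taquin slides of the space located at cell (r , c).
-- The fuel argument bounds the number of slides; the space moves to a
-- new cell at each slide, so fuel = (number of cells) suffices
-- (it is never exhausted in `minus` below).
slide : ℕ → Tableau → ℕ → ℕ → Tableau
slide zero    t r c = t
slide (suc k) t r c with entry t r (suc c) | entry t (suc r) c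
... | just x  | nothing = slide k (setEntry t r c x) r (suc c)
... | just x  | just y  = if x <ᵇ y
                           then slide k (setEntry t r c x) r (suc c)
                           else slide k (setEntry t r c y) (suc r) c
... | nothing | just y  = slide k (setEntry t r c y) (suc r) c
... | nothing | nothing = dropLastOfRow t r

posInRow : List ℕ → ℕ → Maybe ℕ
posInRow []       m = nothing
posInRow (x ∷ xs) m with x ≡ᵇ m
... | true  = just zero
... | false with posInRow xs m
...   | just i  = just (suc i)
...   | nothing = nothing

posOf : Tableau → ℕ → Maybe (ℕ × ℕ)
posOf []         m = nothing
posOf (row ∷ rs) m with posInRow row m
... | just c  = just (zero , c)
... | nothing with posOf rs m
...   | just (r , c) = just (suc r , c)
...   | nothing      = nothing

numCells : Tableau → ℕ
numCells t = sum (map length t)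

renumber : ℕ → Tableau → Tableau
renumber m = map (map (λ p → if m <ᵇ p then p ∸ 1 else p))

minus : Tableau → ℕ → Tableau
minus t m with posOf t m
... | nothing      = t
... | just (r , c) = renumber m (slide (numCells t) t r c)

oneTo : ℕ → List ℕ
oneTo n = map suc (upTo n)

NonEmpty : List ℕ → Set
NonEmpty []      = ⊥
NonEmpty (_ ∷ _) = ⊤

_≥_ : ℕ → ℕ → Set
a ≥ b = b ≤ a

record IsSYT (n : ℕ) (T : Tableau) : Set where
  field
    rowsNonEmpty : All NonEmpty T
    shape        : Linked _≥_ (map length T)
    entries      : concat T ↭ oneTo n
    rowIncr      : ∀ r c x y → entry T r c ≡ just x → entry T r (suc c) ≡ just y → x < y
    colIncr      : ∀ r c x y → entry T r c ≡ just x → entry T (suc r) c ≡ just y → x < y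

IsOneMinor : ℕ → Tableau → Tableau → Set
IsOneMinor n T S = ∃[ m ] (1 ≤ m × m ≤ n × minus T m ≡ S)

{-# OPTIONS --safe #-}
-- Let n sit in cell p of T and in cell p′ of T′, and suppose p ≠ p′. Removing the entry of a
-- corner k of T deletes k from the shape, and every 1-minor of T′ has the shape of T′ with some
-- corner deleted; so the two shapes have the same corner deletions, which for at least three
-- cells forces them to be equal. In every 1-minor of T′ that still has the cell p′, that cell
-- holds n − 1. Hence T holds n − 1 at p′, and removing an entry w < n − 1 from T must delete
-- the cell p′, since otherwise p′ would keep n − 1, renumbered to n − 2. Consequently T has no
-- corner besides p and p′, and the cells diagonally below-left and above-right of p are present
-- (otherwise removing the entry left of, or above, p slides n into p and deletes p instead);
-- symmetrically for p′. The only such shape is the hook with three cells, contradicting n ≥ 4.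
module Submission where

open import Defs
open import Data.Bool using (true; false; if_then_else_)
import Data.Bool as Bool
open import Data.Empty using (⊥-elim)
open import Data.Fin using (Fin; toℕ; inject≤)
import Data.Fin as Fin
open import Data.Fin.Properties using (pigeonhole; toℕ-injective; inject≤-injective; toℕ<n) renaming (<⇒≢ to Fin<⇒≢)
open import Data.List using (List; []; _∷_; map; length; concat; _++_)
open import Data.List.Membership.Propositional using (_∈_)
open import Data.List.Properties using (length-map)
open import Data.List.Membership.Propositional.Properties using (∈-map⁺; ∈-map⁻; ∈-++⁺ˡ; ∈-++⁺ʳ; ∈-++⁻; ∈-upTo⁺; ∈-upTo⁻)
open import Data.List.Relation.Binary.Permutation.Propositional using (↭-sym; ↭⇒↭ₛ)
open import Data.List.Relation.Binary.Permutation.Propositional.Properties using (∈-resp-↭)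
open import Data.List.Relation.Binary.Permutation.Setoid.Properties using (Unique-resp-↭)
open import Data.List.Relation.Unary.All using (All; []; _∷_; lookup)
open import Data.List.Relation.Unary.All.Properties using (++⁻)
open import Data.List.Relation.Unary.Any using (here; there; index)
open import Data.List.Relation.Unary.Any.Properties using (lookup-index)
open import Data.List.Relation.Unary.Linked using (Linked; []; _∷_)
import Data.List.Relation.Unary.Linked as Linked
open import Data.List.Relation.Unary.Unique.Propositional using (Unique; []; _∷_)
open import Data.List.Relation.Unary.Unique.Propositional.Properties using (upTo⁺; map⁺)
open import Data.Maybe using (Maybe; just; nothing)
open import Data.Maybe.Properties using (just-injective)
import Data.Maybe as Maybe
open import Data.Nat using (ℕ; zero; suc; _+_; _∸_; _≤_; _<_; _<ᵇ_; _≡ᵇ_; z≤n; s≤s; _≟_; _<?_; _≤?_)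
open import Data.Nat.Properties
open import Data.Product using (_×_; _,_; ∃-syntax; Σ-syntax; proj₁; proj₂; swap)
open import Data.Product.Properties using (≡-dec)
open import Data.Sum using (_⊎_; inj₁; inj₂)
import Data.Sum
open import Data.Unit using (tt)
open import Function using (id; _∘_; _∘₂_)
open import Function.Bundles using (_⇔_; Equivalence)
open import Function.Definitions using (Injective)
open import Level using (0ℓ)
open import Relation.Binary.Definitions using (DecidableEquality; tri<; tri≈; tri>)
open import Relation.Binary.PropositionalEquality using (_≡_; _≢_; refl; sym; trans; cong; cong₂; subst; setoid; module ≡-Reasoning)
open import Relation.Nullary using (¬_; yes; no; contradiction)
open import Relation.Unary using (Pred; Decidable; _⊆′_; _≐′_)

-- Cells and shapes

Cell : Set
Cell = ℕ × ℕ

_≟ᶜ_ : DecidableEquality Cell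
_≟ᶜ_ = ≡-dec _≟_ _≟_

_≼_ : Cell → Cell → Set
(r , c) ≼ (r′ , c′) = r ≤ r′ × c ≤ c′

_∖_ : Pred Cell 0ℓ → Cell → Pred Cell 0ℓ
(C ∖ k) q = C q × q ≢ k

DownClosed : Pred Cell 0ℓ → Set
DownClosed C = ∀ {q k} → q ≼ k → C k → C q

Corner : Pred Cell 0ℓ → Pred Cell 0ℓ
Corner C (r , c) = C (r , c) × ¬ C (r , suc c) × ¬ C (suc r , c)

CornerCovered : Pred Cell 0ℓ → Set
CornerCovered C = ∀ q → C q → ∃[ k ] Corner C k × q ≼ k

AtLeast : ℕ → Pred Cell 0ℓ → Set
AtLeast k C = Σ[ f ∈ (Fin k → Cell) ] Injective _≡_ _≡_ f × (∀ i → C (f i))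

Flanked : Pred Cell 0ℓ → Cell → Set
Flanked C (r , c) = (∀ {c₀} → c ≡ suc c₀ → C (suc r , c₀)) × (∀ {r₀} → r ≡ suc r₀ → C (r₀ , suc c))

corner-≐ : ∀ {C D q} → C ≐′ D → Corner C q → Corner D q
corner-≐ (to , from) (q∈C , right∉C , below∉C) = to _ q∈C , right∉C ∘ from _ , below∉C ∘ from _

flanked-≐ : ∀ {C D q} → C ≐′ D → Flanked C q → Flanked D q
flanked-≐ (to , _) (lower , upper) = to _ ∘ lower , to _ ∘ upper

≼-refl : ∀ {q} → q ≼ q
≼-refl = ≤-refl , ≤-refl

≼-trans : ∀ {q k l} → q ≼ k → k ≼ l → q ≼ l
≼-trans (r≤ , c≤) (r≤′ , c≤′) = ≤-trans r≤ r≤′ , ≤-trans c≤ c≤′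

cornerCovered : ∀ {C} → Decidable C → (N : ℕ) → (∀ {r c} → C (r , c) → r + c < N) → CornerCovered C
cornerCovered {C} C? N bound (r , c) q∈C = walk N r c q∈C (m≤n+m N (r + c))
  where
  walk : ∀ fuel r c → C (r , c) → N ≤ r + c + fuel → ∃[ k ] Corner C k × (r , c) ≼ k
  walk zero r c q∈C N≤ = contradiction (subst (N ≤_) (+-identityʳ (r + c)) N≤) (<⇒≱ (bound q∈C))
  walk (suc fuel) r c q∈C N≤ with C? (r , suc c) | C? (suc r , c)
  ... | yes right∈C | _ =
    let k , k-corner , right≼k = walk fuel r (suc c) right∈C (subst (N ≤_) (+-suc-shift r c fuel) N≤)
    in k , k-corner , ≼-trans (≤-refl , n≤1+n c) right≼k
    where
    +-suc-shift : ∀ r c fuel → r + c + suc fuel ≡ r + suc c + fuel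
    +-suc-shift r c fuel = trans (+-suc (r + c) fuel) (cong (_+ fuel) (sym (+-suc r c)))
  ... | no _ | yes below∈C =
    let k , k-corner , below≼k = walk fuel (suc r) c below∈C (subst (N ≤_) (+-suc (r + c) fuel) N≤)
    in k , k-corner , ≼-trans (n≤1+n r , ≤-refl) below≼k
  ... | no right∉C | no below∉C = (r , c) , (q∈C , right∉C , below∉C) , ≼-refl

atLeast-≤ : ∀ {j k C} → j ≤ k → AtLeast k C → AtLeast j C
atLeast-≤ j≤k (f , f-injective , f∈C) =
  f ∘ (λ i → inject≤ i j≤k) , inject≤-injective j≤k j≤k _ _ ∘ f-injective , f∈C ∘ (λ i → inject≤ i j≤k)

atLeast⇒≤length : ∀ {k C} (cs : List Cell) → AtLeast k C → (∀ q → C q → q ∈ cs) → k ≤ length cs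
atLeast⇒≤length {k} cs (f , f-injective , f∈C) C⊆cs with k ≤? length cs
... | yes k≤ = k≤
... | no k≰ with pigeonhole (≰⇒> k≰) (λ i → index (C⊆cs (f i) (f∈C i)))
... | i , j , i<j , same-index = contradiction (f-injective f[i]≡f[j]) (Fin<⇒≢ i<j)
  where
  f[i]≡f[j] : f i ≡ f j
  f[i]≡f[j] = trans (lookup-index (C⊆cs (f i) (f∈C i)))
                    (trans (cong (Data.List.lookup cs) same-index) (sym (lookup-index (C⊆cs (f j) (f∈C j)))))

corner-column-unique : ∀ {C r c c′} → DownClosed C → Corner C (r , c) → Corner C (r , c′) → c ≡ c′
corner-column-unique {c = c} {c′} C↓ (q∈C , right∉C , _) (q′∈C , right′∉C , _) with <-cmp c c′
... | tri≈ _ c≡c′ _ = c≡c′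
... | tri< c<c′ _ _ = contradiction (C↓ (≤-refl , c<c′) q′∈C) right∉C
... | tri> _ _ c′<c = contradiction (C↓ (≤-refl , c′<c) q∈C) right′∉C

deck-soleCorner : ∀ {C C′} → (∀ k → Corner C k → ∃[ e ] Corner C′ e × (C ∖ k) ≐′ (C′ ∖ e)) →
  ∀ {p e₀} → (C ∖ p) ≐′ (C′ ∖ e₀) → C p → ¬ C′ p → ∀ k → Corner C k → k ≡ p
deck-soleCorner deck {p} (to₀ , _) p∈C p∉C′ k k-corner with k ≟ᶜ p
... | yes k≡p = k≡p
... | no k≢p with deck k k-corner
...   | e , _ , (to , from) with k ≟ᶜ e
...     | yes refl = contradiction (proj₁ (to p (p∈C , k≢p ∘ sym))) p∉C′
...     | no k≢e = contradiction refl (proj₂ (from k (proj₁ (to₀ k (proj₁ k-corner , k≢p)) , k≢e)))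

soleCorner⇒≼ : ∀ {C p} → CornerCovered C → (∀ k → Corner C k → k ≡ p) → ∀ q → C q → q ≼ p
soleCorner⇒≼ C-covered sole q q∈C with C-covered q q∈C
... | k , k-corner , q≼k rewrite sole k k-corner = q≼k

OnAxis : Cell → Set
OnAxis (r , c) = r ≡ 0 ⊎ c ≡ 0

onAxis : ∀ {C p e} → DownClosed C → C p → (∀ q → (C ∖ p) q → q ≼ e) → ¬ p ≼ e → OnAxis p
onAxis {p = zero , _} _ _ _ _ = inj₁ refl
onAxis {p = suc _ , zero} _ _ _ _ = inj₂ refl
onAxis {p = suc a , suc b} C↓ p∈C C∖p≼e p⋠e = contradiction (a<e₁ , b<e₂) p⋠e
  where
  a<e₁ = proj₁ (C∖p≼e (suc a , b) (C↓ (≤-refl , n≤1+n b) p∈C , λ ()))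
  b<e₂ = proj₂ (C∖p≼e (a , suc b) (C↓ (n≤1+n a , ≤-refl) p∈C , λ ()))

onAxis-incomparable : ∀ {q p e} → OnAxis p → OnAxis e → ¬ p ≼ e → ¬ e ≼ p → q ≼ p → q ≼ e → q ≡ (0 , 0)
onAxis-incomparable {p = _ , b} {e = _ , b′} (inj₁ refl) (inj₁ refl) p⋠e e⋠p _ _ with ≤-total b b′
... | inj₁ b≤b′ = contradiction (z≤n , b≤b′) p⋠e
... | inj₂ b′≤b = contradiction (z≤n , b′≤b) e⋠p
onAxis-incomparable {p = a , _} {e = a′ , _} (inj₂ refl) (inj₂ refl) p⋠e e⋠p _ _ with ≤-total a a′
... | inj₁ a≤a′ = contradiction (a≤a′ , z≤n) p⋠e
... | inj₂ a′≤a = contradiction (a′≤a , z≤n) e⋠p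
onAxis-incomparable (inj₁ refl) (inj₂ refl) _ _ (r≤0 , _) (_ , c≤0) = cong₂ _,_ (n≤0⇒n≡0 r≤0) (n≤0⇒n≡0 c≤0)
onAxis-incomparable (inj₂ refl) (inj₁ refl) _ _ (_ , c≤0) (r≤0 , _) = cong₂ _,_ (n≤0⇒n≡0 r≤0) (n≤0⇒n≡0 c≤0)

module _ {C C′ : Pred Cell 0ℓ} (C↓ : DownClosed C) (C′↓ : DownClosed C′) where

  -- p and e are forced onto different axes, so that C ∖ p ⊆ {(0 , 0)}.
  rectangles-deck : ∀ {p e} → C p → C′ e → (∀ q → C q → q ≼ p) → (∀ q → C′ q → q ≼ e) →
    (C ∖ p) ≐′ (C′ ∖ e) → ¬ C′ p → ¬ C e → ¬ AtLeast 3 C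
  rectangles-deck {p} {e} p∈C e∈C′ C≼p C′≼e (to , from) p∉C′ e∉C three =
    contradiction (atLeast⇒≤length ((0 , 0) ∷ p ∷ []) three C⊆) (<⇒≱ ≤-refl)
    where
    C∖p≼e : ∀ q → (C ∖ p) q → q ≼ e
    C∖p≼e q q∈C∖p = C′≼e q (proj₁ (to q q∈C∖p))
    C′∖e≼p : ∀ q → (C′ ∖ e) q → q ≼ p
    C′∖e≼p q q∈C′∖e = C≼p q (proj₁ (from q q∈C′∖e))
    p⋠e : ¬ p ≼ e
    p⋠e p≼e = p∉C′ (C′↓ p≼e e∈C′)
    e⋠p : ¬ e ≼ p
    e⋠p e≼p = e∉C (C↓ e≼p p∈C)
    C⊆ : ∀ q → C q → q ∈ (0 , 0) ∷ p ∷ []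
    C⊆ q q∈C with q ≟ᶜ p
    ... | yes q≡p = there (here q≡p)
    ... | no q≢p = here (onAxis-incomparable (onAxis C↓ p∈C C∖p≼e p⋠e) (onAxis C′↓ e∈C′ C′∖e≼p e⋠p)
                           p⋠e e⋠p (C≼p q q∈C) (C∖p≼e q (q∈C , q≢p)))

  -- Match a corner p of C with a corner e of C′. If p ≠ e, then p and e are the only corners
  -- of C and C′, which are thus rectangles.
  deck⇒≐ : CornerCovered C → CornerCovered C′ → AtLeast 3 C →
    (∀ k → Corner C k → ∃[ e ] Corner C′ e × (C ∖ k) ≐′ (C′ ∖ e)) →
    (∀ e → Corner C′ e → ∃[ k ] Corner C k × (C′ ∖ e) ≐′ (C ∖ k)) → C ≐′ C′
  deck⇒≐ C-covered C′-covered three@(f , _ , f∈C) deck deck′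
    with C-covered (f Fin.zero) (f∈C Fin.zero)
  ... | p , p-corner , _ with deck p p-corner
  ... | e , e-corner , (to , from) with p ≟ᶜ e
  ...   | yes refl = C⊆C′ , C′⊆C
    where
    C⊆C′ : C ⊆′ C′
    C⊆C′ q q∈C with q ≟ᶜ p
    ... | yes refl = proj₁ e-corner
    ... | no q≢p = proj₁ (to q (q∈C , q≢p))
    C′⊆C : C′ ⊆′ C
    C′⊆C q q∈C′ with q ≟ᶜ p
    ... | yes refl = proj₁ p-corner
    ... | no q≢p = proj₁ (from q (q∈C′ , q≢p))
  ...   | no p≢e = ⊥-elim (rectangles-deck p∈C e∈C′
                      (soleCorner⇒≼ C-covered (deck-soleCorner deck (to , from) p∈C p∉C′))
                      (soleCorner⇒≼ C′-covered (deck-soleCorner deck′ (from , to) e∈C′ e∉C))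
                      (to , from) p∉C′ e∉C three)
    where
    p∈C = proj₁ p-corner
    e∈C′ = proj₁ e-corner
    p∉C′ : ¬ C′ p
    p∉C′ p∈C′ = proj₂ (from p (p∈C′ , p≢e)) refl
    e∉C : ¬ C e
    e∉C e∈C = proj₂ (to e (e∈C , p≢e ∘ sym)) refl

module _ {C : Pred Cell 0ℓ} where

  UnderEither : Cell → Cell → Set
  UnderEither p p′ = ∀ q → C q → q ≼ p ⊎ q ≼ p′

  twoCorners-column< : ∀ {r c r′ c′} → DownClosed C → Corner C (r , c) → C (r′ , c′) → r < r′ → c′ < c
  twoCorners-column< {c = c} {c′ = c′} C↓ (_ , _ , below∉C) p′∈C r<r′ with c ≤? c′
  ... | yes c≤c′ = contradiction (C↓ (r<r′ , c≤c′) p′∈C) below∉C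
  ... | no c≰c′ = ≰⇒> c≰c′

  twoCorners-row≡0 : ∀ {r c r′ c′} → UnderEither (r , c) (r′ , c′) → c′ < c → Flanked C (r , c) → r ≡ 0
  twoCorners-row≡0 {zero} _ _ _ = refl
  twoCorners-row≡0 {suc r} {c} under c′<c (_ , upper) with under (r , suc c) (upper refl)
  ... | inj₁ (_ , c<c) = contradiction c<c (<-irrefl refl)
  ... | inj₂ (_ , c<c′) = contradiction (<-trans c<c′ c′<c) (<-irrefl refl)

  twoCorners-column≡0 : ∀ {r c r′ c′} → UnderEither (r , c) (r′ , c′) → r < r′ → Flanked C (r′ , c′) →
    c′ ≡ 0
  twoCorners-column≡0 {c′ = zero} _ _ _ = refl
  twoCorners-column≡0 {r′ = r′} {suc c′} under r<r′ (lower , _) with under (suc r′ , c′) (lower refl)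
  ... | inj₁ (r′<r , _) = contradiction (<-trans r′<r r<r′) (<-irrefl refl)
  ... | inj₂ (r′<r′ , _) = contradiction r′<r′ (<-irrefl refl)

  twoCorners-row≡1 : ∀ {c r′} → UnderEither (0 , c) (r′ , 0) → 0 < r′ → Flanked C (r′ , 0) → r′ ≡ 1
  twoCorners-row≡1 {r′ = suc zero} _ _ _ = refl
  twoCorners-row≡1 {r′ = suc (suc r′)} under _ (_ , upper) with under (suc r′ , 1) (upper refl)
  ... | inj₁ (() , _)
  ... | inj₂ (_ , ())

  twoCorners-column≡1 : ∀ {c r′} → UnderEither (0 , c) (r′ , 0) → 0 < c → Flanked C (0 , c) → c ≡ 1
  twoCorners-column≡1 {c = suc zero} _ _ _ = refl
  twoCorners-column≡1 {c = suc (suc c)} under _ (lower , _) with under (1 , suc c) (lower refl)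
  ... | inj₁ (() , _)
  ... | inj₂ (_ , ())

  twoCorners-under : ∀ {p p′} → CornerCovered C → (∀ k → Corner C k → k ≡ p ⊎ k ≡ p′) → UnderEither p p′
  twoCorners-under C-covered sole q q∈C with C-covered q q∈C
  ... | k , k-corner , q≼k with sole k k-corner
  ...   | inj₁ refl = inj₁ q≼k
  ...   | inj₂ refl = inj₂ q≼k

  twoFlankedCorners⊆ : ∀ {r c r′ c′} → DownClosed C → CornerCovered C → r < r′ →
    Corner C (r , c) → Corner C (r′ , c′) → (∀ k → Corner C k → k ≡ (r , c) ⊎ k ≡ (r′ , c′)) →
    Flanked C (r , c) → Flanked C (r′ , c′) → ∀ q → C q → q ∈ (0 , 0) ∷ (0 , 1) ∷ (1 , 0) ∷ []
  twoFlankedCorners⊆ C↓ C-covered r<r′ p-corner p′-corner sole p-flanked p′-flanked q q∈C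
    with under ← twoCorners-under C-covered sole
    with c′<c ← twoCorners-column< C↓ p-corner (proj₁ p′-corner) r<r′
    with refl ← twoCorners-row≡0 under c′<c p-flanked
    with refl ← twoCorners-column≡0 under r<r′ p′-flanked
    with refl ← twoCorners-row≡1 under r<r′ p′-flanked
    with refl ← twoCorners-column≡1 under c′<c p-flanked
    = hook-cells (under q q∈C)
    where
    hook-cells : ∀ {q} → q ≼ (0 , 1) ⊎ q ≼ (1 , 0) → q ∈ (0 , 0) ∷ (0 , 1) ∷ (1 , 0) ∷ []
    hook-cells {zero , zero} _ = here refl
    hook-cells {zero , suc zero} _ = there (here refl)
    hook-cells {suc zero , zero} _ = there (there (here refl))
    hook-cells {zero , suc (suc _)} (inj₁ (_ , s≤s ()))
    hook-cells {zero , suc (suc _)} (inj₂ (_ , ()))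
    hook-cells {suc zero , suc _} (inj₁ (() , _))
    hook-cells {suc zero , suc _} (inj₂ (_ , ()))
    hook-cells {suc (suc _) , _} (inj₁ (() , _))
    hook-cells {suc (suc _) , _} (inj₂ (s≤s () , _))

-- Tableaux as lists of rows

rowLen : Tableau → ℕ → ℕ
rowLen []         _       = 0
rowLen (row ∷ rs) zero    = length row
rowLen (row ∷ rs) (suc r) = rowLen rs r

Shape : Tableau → Pred Cell 0ℓ
Shape t (r , c) = c < rowLen t r

_[_] : Tableau → Cell → Maybe ℕ
t [ r , c ] = entry t r c

record SameShape (t u : Tableau) : Set where
  constructor sameRowLengths
  field rowLen≡ : ∀ r → rowLen t r ≡ rowLen u r

sameShape-sym : ∀ {t u} → SameShape t u → SameShape u t
sameShape-sym (sameRowLengths same) = sameRowLengths (sym ∘ same)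

sameShape-trans : ∀ {t u v} → SameShape t u → SameShape u v → SameShape t v
sameShape-trans (sameRowLengths same) (sameRowLengths same′) = sameRowLengths λ r → trans (same r) (same′ r)

sameShape⇒⊆ : ∀ {t u} → SameShape t u → Shape t ⊆′ Shape u
sameShape⇒⊆ (sameRowLengths same) (r , c) = subst (c <_) (same r)

at≡just⇒< : ∀ xs {i v} → at xs i ≡ just v → i < length xs
at≡just⇒< (x ∷ xs) {zero}  _  = s≤s z≤n
at≡just⇒< (x ∷ xs) {suc i} eq = s≤s (at≡just⇒< xs eq)

<⇒at≡just : ∀ xs {i} → i < length xs → ∃[ v ] at xs i ≡ just v
<⇒at≡just (x ∷ xs) {zero}  _         = x , refl
<⇒at≡just (x ∷ xs) {suc i} (s≤s i<) = <⇒at≡just xs i<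

entry⇒shape : ∀ t {q v} → t [ q ] ≡ just v → Shape t q
entry⇒shape (row ∷ rs) {zero , c}  = at≡just⇒< row
entry⇒shape (row ∷ rs) {suc r , c} = entry⇒shape rs

shape⇒entry : ∀ t {q} → Shape t q → ∃[ v ] t [ q ] ≡ just v
shape⇒entry (row ∷ rs) {zero , c}  = <⇒at≡just row
shape⇒entry (row ∷ rs) {suc r , c} = shape⇒entry rs

∉shape⇒entry≡nothing : ∀ t {q} → ¬ Shape t q → t [ q ] ≡ nothing
∉shape⇒entry≡nothing t {q} q∉t with t [ q ] in eq
... | just _  = contradiction (entry⇒shape t eq) q∉t
... | nothing = refl

shape? : ∀ t → Decidable (Shape t)
shape? t (r , c) = c <? rowLen t r

setAt-length : ∀ xs i v → length (setAt xs i v) ≡ length xs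
setAt-length []       _       _ = refl
setAt-length (x ∷ xs) zero    _ = refl
setAt-length (x ∷ xs) (suc i) v = cong suc (setAt-length xs i v)

at-setAt-≢ : ∀ xs {i j} v → j ≢ i → at (setAt xs i v) j ≡ at xs j
at-setAt-≢ []       _ _ = refl
at-setAt-≢ (x ∷ xs) {zero}  {zero}  _ j≢i = contradiction refl j≢i
at-setAt-≢ (x ∷ xs) {zero}  {suc j} _ _   = refl
at-setAt-≢ (x ∷ xs) {suc i} {zero}  _ _   = refl
at-setAt-≢ (x ∷ xs) {suc i} {suc j} v j≢i = at-setAt-≢ xs v (j≢i ∘ cong suc)

setEntry-sameShape : ∀ t r c v → SameShape (setEntry t r c v) t
setEntry-sameShape t r c v = sameRowLengths (same t r)
  where
  same : ∀ t r i → rowLen (setEntry t r c v) i ≡ rowLen t i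
  same []         _       _       = refl
  same (row ∷ rs) zero    zero    = setAt-length row c v
  same (row ∷ rs) zero    (suc i) = refl
  same (row ∷ rs) (suc r) zero    = refl
  same (row ∷ rs) (suc r) (suc i) = same rs r i

entry-setEntry-≢ : ∀ t {r c} v {q} → q ≢ (r , c) → setEntry t r c v [ q ] ≡ t [ q ]
entry-setEntry-≢ []         _ _ = refl
entry-setEntry-≢ (row ∷ rs) {zero}  v {zero , j}  q≢ = at-setAt-≢ row v (q≢ ∘ cong (0 ,_))
entry-setEntry-≢ (row ∷ rs) {zero}  v {suc i , j} q≢ = refl
entry-setEntry-≢ (row ∷ rs) {suc r} v {zero , j}  q≢ = refl
entry-setEntry-≢ (row ∷ rs) {suc r} v {suc i , j} q≢ = entry-setEntry-≢ rs v (q≢ ∘ cong (λ (a , b) → suc a , b))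

setEntry-nonEmpty : ∀ t r c v → All NonEmpty t → All NonEmpty (setEntry t r c v)
setEntry-nonEmpty []               _       _ _ []         = []
setEntry-nonEmpty ((x ∷ xs) ∷ rs) zero    zero    v (_ ∷ ne) = tt ∷ ne
setEntry-nonEmpty ((x ∷ xs) ∷ rs) zero    (suc c) v (_ ∷ ne) = tt ∷ ne
setEntry-nonEmpty (row ∷ rs)       (suc r) c v (nr ∷ ne) = nr ∷ setEntry-nonEmpty rs r c v ne

renum : ℕ → ℕ → ℕ
renum m p = if m <ᵇ p then p ∸ 1 else p

renum-> : ∀ {m p} → m < p → renum m p ≡ p ∸ 1
renum-> {m} {p} m<p with m <ᵇ p in eq
... | true  = refl
... | false = ⊥-elim (subst Bool.T eq (<⇒<ᵇ m<p))

renum-≤ : ∀ {m p} → p ≤ m → renum m p ≡ p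
renum-≤ {m} {p} p≤m with m <ᵇ p in eq
... | true  = contradiction (<ᵇ⇒< m p (subst Bool.T (sym eq) tt)) (≤⇒≯ p≤m)
... | false = refl

entry-renumber : ∀ m t q → renumber m t [ q ] ≡ Maybe.map (renum m) (t [ q ])
entry-renumber m (row ∷ rs) (zero , c)  = at-map row c
  where
  at-map : ∀ xs i → at (map (renum m) xs) i ≡ Maybe.map (renum m) (at xs i)
  at-map []       _       = refl
  at-map (x ∷ xs) zero    = refl
  at-map (x ∷ xs) (suc i) = at-map xs i
entry-renumber m []         _           = refl
entry-renumber m (row ∷ rs) (suc r , c) = entry-renumber m rs (r , c)

renumber-sameShape : ∀ m t → SameShape (renumber m t) t
renumber-sameShape m t = sameRowLengths (same t)
  where
  same : ∀ t r → rowLen (renumber m t) r ≡ rowLen t r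
  same []         _       = refl
  same (row ∷ rs) zero    = length-map _ row
  same (row ∷ rs) (suc r) = same rs r

record Deletes (k : Cell) (t u : Tableau) : Set where
  constructor deletes
  field
    emptied   : u [ k ] ≡ nothing
    unchanged : ∀ q → q ≢ k → u [ q ] ≡ t [ q ]

deletes⇒shape : ∀ {k t u} → Deletes k t u → Shape u ≐′ Shape t ∖ k
deletes⇒shape {k} {t} {u} (deletes k-empty others) = to , from
  where
  to : Shape u ⊆′ Shape t ∖ k
  to q q∈u with shape⇒entry u q∈u
  ... | v , u[q] with q ≟ᶜ k
  ...   | yes refl = contradiction (trans (sym u[q]) k-empty) λ ()
  ...   | no q≢k = entry⇒shape t (trans (sym (others q q≢k)) u[q]) , q≢k
  from : Shape t ∖ k ⊆′ Shape u
  from q (q∈t , q≢k) = entry⇒shape u (trans (others q q≢k) (proj₂ (shape⇒entry t q∈t)))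

dropLastElem-deletes : ∀ xs {c} → suc c ≡ length xs →
  at (dropLastElem xs) c ≡ nothing × (∀ j → j ≢ c → at (dropLastElem xs) j ≡ at xs j)
dropLastElem-deletes (x ∷ []) refl = refl , others
  where
  others : ∀ j → j ≢ 0 → at [] j ≡ at (x ∷ []) j
  others zero    j≢0 = contradiction refl j≢0
  others (suc j) _   = refl
dropLastElem-deletes (x ∷ y ∷ xs) {suc c} len with dropLastElem-deletes (y ∷ xs) (suc-injective len)
... | last , others = last , λ where
  zero    _   → refl
  (suc j) j≢c → others j (j≢c ∘ cong suc)

dropLastOfRow-deletes : ∀ t {r c} → All NonEmpty t → Corner (Shape t) (r , c) → Deletes (r , c) t (dropLastOfRow t r)
dropLastOfRow-deletes ([] ∷ _) {zero} (() ∷ _) _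
dropLastOfRow-deletes ((x ∷ []) ∷ []) {zero} {zero} _ _ = deletes refl λ where
  (zero , zero)  q≢ → contradiction refl q≢
  (zero , suc j) _  → refl
  (suc i , j)    _  → refl
dropLastOfRow-deletes ((x ∷ []) ∷ ([] ∷ _)) {zero} {zero} (_ ∷ () ∷ _) _
dropLastOfRow-deletes ((x ∷ []) ∷ ((_ ∷ _) ∷ _)) {zero} {zero} _ (_ , _ , below∉t) = contradiction (s≤s z≤n) below∉t
dropLastOfRow-deletes ((x ∷ []) ∷ _) {zero} {suc c} _ (s≤s () , _)
dropLastOfRow-deletes (row@(x ∷ y ∷ xs) ∷ rs) {zero} {c} _ (c<len , ¬c+1<len , _)
  with dropLastElem-deletes row {c} (≤-antisym c<len (≮⇒≥ ¬c+1<len))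
... | last , others = deletes last λ where
  (zero , j)  j≢c → others j (j≢c ∘ cong (0 ,_))
  (suc i , j) _   → refl
dropLastOfRow-deletes (row ∷ rs) {suc r} (_ ∷ rs-nonEmpty) corner
  with dropLastOfRow-deletes rs rs-nonEmpty corner
... | deletes last others = deletes last λ where
  (zero , j)  _  → refl
  (suc i , j) q≢ → others (i , j) (q≢ ∘ cong (λ (a , b) → suc a , b))

-- Jeu de taquin

slide-right : ∀ k t r c {x} → t [ r , suc c ] ≡ just x → t [ suc r , c ] ≡ nothing →
  slide (suc k) t r c ≡ slide k (setEntry t r c x) r (suc c)
slide-right k t r c right below rewrite right | below = refl

slide-down : ∀ k t r c {y} → t [ r , suc c ] ≡ nothing → t [ suc r , c ] ≡ just y →
  slide (suc k) t r c ≡ slide k (setEntry t r c y) (suc r) c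
slide-down k t r c right below rewrite right | below = refl

slide-stop : ∀ k t r c → t [ r , suc c ] ≡ nothing → t [ suc r , c ] ≡ nothing →
  slide (suc k) t r c ≡ dropLastOfRow t r
slide-stop k t r c right below rewrite right | below = refl

row+column<numCells : ∀ t {r c} → All NonEmpty t → Shape t (r , c) → r + c < numCells t
row+column<numCells (row ∷ rs) {zero} _ c<len = ≤-trans c<len (m≤m+n (length row) (numCells rs))
row+column<numCells ([] ∷ rs) {suc r} (() ∷ _) _
row+column<numCells ((x ∷ xs) ∷ rs) {suc r} (_ ∷ rs-nonEmpty) q∈rs =
  s≤s (≤-trans (row+column<numCells rs rs-nonEmpty q∈rs) (m≤n+m (numCells rs) (length xs)))

sameShape-corner : ∀ {t u q} → SameShape t u → Corner (Shape u) q → Corner (Shape t) q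
sameShape-corner same (q∈u , right∉u , below∉u) =
  sameShape⇒⊆ (sameShape-sym same) _ q∈u , right∉u ∘ sameShape⇒⊆ same _ , below∉u ∘ sameShape⇒⊆ same _

-- t is a stage of jeu de taquin on T, with the space at q.
record SlideState (T : Tableau) (q : Cell) (t : Tableau) : Set where
  field
    sameShape : SameShape t T
    nonEmpty  : All NonEmpty t
    corners   : ∀ p → Corner (Shape T) p → p ≢ q → t [ p ] ≡ T [ p ]

record DeletesCorner (f : Maybe ℕ → Maybe ℕ) (T : Tableau) (e : Cell) (u : Tableau) : Set where
  field
    corner  : Corner (Shape T) e
    shape   : Shape u ≐′ Shape T ∖ e
    corners : ∀ p → Corner (Shape T) p → p ≢ e → u [ p ] ≡ f (T [ p ])

deletesCorner-unique : ∀ {f g T e e′ u} → DeletesCorner f T e u → DeletesCorner g T e′ u → e ≡ e′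
deletesCorner-unique {e = e} {e′} d d′ with e ≟ᶜ e′
... | yes e≡e′ = e≡e′
... | no e≢e′ = contradiction refl (proj₂ (proj₁ (DeletesCorner.shape d) e e∈u))
  where
  e∈u = proj₂ (DeletesCorner.shape d′) e (proj₁ (DeletesCorner.corner d) , e≢e′)

initialState : ∀ {T q} → All NonEmpty T → SlideState T q T
initialState T-nonEmpty = record { sameShape = sameRowLengths λ _ → refl ; nonEmpty = T-nonEmpty ; corners = λ _ _ _ → refl }

-- The space only leaves non-corner cells, so corners are never overwritten.
setEntry-state : ∀ {T t r c} → SlideState T (r , c) t → ¬ Corner (Shape T) (r , c) →
  ∀ q v → SlideState T q (setEntry t r c v)
setEntry-state {T} {t} {r} {c} st ¬corner q v = record
  { sameShape = sameShape-trans (setEntry-sameShape t r c v) sameShape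
  ; nonEmpty  = setEntry-nonEmpty t r c v nonEmpty
  ; corners   = λ p p-corner _ → trans (entry-setEntry-≢ t v (p≢space p p-corner)) (corners p p-corner (p≢space p p-corner))
  }
  where
  open SlideState st
  p≢space : ∀ p → Corner (Shape T) p → p ≢ (r , c)
  p≢space p p-corner refl = ¬corner p-corner

dropLastOfRow-deletesCorner : ∀ {T t r c} → SlideState T (r , c) t → Corner (Shape T) (r , c) →
  DeletesCorner id T (r , c) (dropLastOfRow t r)
dropLastOfRow-deletesCorner {T} {t} {r} {c} st corner = record
  { corner  = corner
  ; shape   = (λ q q∈u → let q∈t , q≢ = to q q∈u in sameShape⇒⊆ sameShape q q∈t , q≢)
            , (λ q (q∈T , q≢) → from q (sameShape⇒⊆ (sameShape-sym sameShape) q q∈T , q≢))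
  ; corners = λ p p-corner p≢ → trans (Deletes.unchanged deleted p p≢) (corners p p-corner p≢)
  }
  where
  open SlideState st
  deleted = dropLastOfRow-deletes t nonEmpty (sameShape-corner sameShape corner)
  to = proj₁ (deletes⇒shape deleted)
  from = proj₂ (deletes⇒shape deleted)

slide-atCorner : ∀ {T t r c} k → SlideState T (r , c) t → Corner (Shape T) (r , c) →
  slide (suc k) t r c ≡ dropLastOfRow t r
slide-atCorner {t = t} {r} {c} k st (_ , right∉T , below∉T) = slide-stop k t r c
  (∉shape⇒entry≡nothing t (right∉T ∘ sameShape⇒⊆ sameShape _))
  (∉shape⇒entry≡nothing t (below∉T ∘ sameShape⇒⊆ sameShape _))
  where open SlideState st

renumber-deletesCorner : ∀ m {T e u} → DeletesCorner id T e u → DeletesCorner (Maybe.map (renum m)) T e (renumber m u)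
renumber-deletesCorner m {u = u} d = record
  { corner  = corner
  ; shape   = (λ q → proj₁ shape q ∘ sameShape⇒⊆ (renumber-sameShape m u) q)
            , (λ q → sameShape⇒⊆ (sameShape-sym (renumber-sameShape m u)) q ∘ proj₂ shape q)
  ; corners = λ p p-corner p≢e → trans (entry-renumber m u p) (cong (Maybe.map (renum m)) (corners p p-corner p≢e))
  }
  where open DeletesCorner d

module _ {T : Tableau} (T-nonEmpty : All NonEmpty T) where

  slide-deletesCorner : ∀ fuel t r c → SlideState T (r , c) t → Shape T (r , c) → numCells T ≤ fuel + (r + c) →
    ∃[ e ] DeletesCorner id T e (slide fuel t r c)
  slideRight : ∀ fuel t r c {x} → SlideState T (r , c) t → numCells T ≤ suc fuel + (r + c) →
    t [ r , suc c ] ≡ just x → ∃[ e ] DeletesCorner id T e (slide fuel (setEntry t r c x) r (suc c))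
  slideDown : ∀ fuel t r c {y} → SlideState T (r , c) t → numCells T ≤ suc fuel + (r + c) →
    t [ suc r , c ] ≡ just y → ∃[ e ] DeletesCorner id T e (slide fuel (setEntry t r c y) (suc r) c)

  slide-deletesCorner zero t r c _ q∈T bound = contradiction bound (<⇒≱ (row+column<numCells T T-nonEmpty q∈T))
  slide-deletesCorner (suc fuel) t r c st q∈T bound
    with t [ r , suc c ] in right | t [ suc r , c ] in below
  ... | just x | nothing = slideRight fuel t r c st bound right
  ... | just x | just y with x <ᵇ y
  ...   | true  = slideRight fuel t r c st bound right
  ...   | false = slideDown fuel t r c st bound below
  slide-deletesCorner (suc fuel) t r c st q∈T bound | nothing | just y = slideDown fuel t r c st bound below
  slide-deletesCorner (suc fuel) t r c st q∈T bound | nothing | nothing =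
    (r , c) , dropLastOfRow-deletesCorner st (q∈T , ∉T right , ∉T below)
    where
    open SlideState st
    ∉T : ∀ {q} → t [ q ] ≡ nothing → ¬ Shape T q
    ∉T {q} t[q]≡nothing q∈T =
      contradiction (trans (sym t[q]≡nothing) (proj₂ (shape⇒entry t (sameShape⇒⊆ (sameShape-sym sameShape) q q∈T)))) λ ()

  slideRight fuel t r c {x} st bound right =
    slide-deletesCorner fuel (setEntry t r c x) r (suc c) (setEntry-state st ¬corner _ x) right∈T
      (subst (numCells T ≤_) (sym (trans (cong (fuel +_) (+-suc r c)) (+-suc fuel (r + c)))) bound)
    where
    right∈T = sameShape⇒⊆ (SlideState.sameShape st) _ (entry⇒shape t right)
    ¬corner : ¬ Corner (Shape T) (r , c)
    ¬corner (_ , right∉T , _) = right∉T right∈T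

  slideDown fuel t r c {y} st bound below =
    slide-deletesCorner fuel (setEntry t r c y) (suc r) c (setEntry-state st ¬corner _ y) below∈T
      (subst (numCells T ≤_) (sym (+-suc fuel (r + c))) bound)
    where
    below∈T = sameShape⇒⊆ (SlideState.sameShape st) _ (entry⇒shape t below)
    ¬corner : ¬ Corner (Shape T) (r , c)
    ¬corner (_ , _ , below∉T) = below∉T below∈T

  slide-fromCorner : ∀ {r c} → Corner (Shape T) (r , c) → ∀ k → DeletesCorner id T (r , c) (slide (suc k) T r c)
  slide-fromCorner corner k =
    subst (DeletesCorner id T _) (sym (slide-atCorner k (initialState T-nonEmpty) corner))
          (dropLastOfRow-deletesCorner (initialState T-nonEmpty) corner)

  slide-rightIntoCorner : ∀ {r c} → Corner (Shape T) (r , suc c) → ¬ Shape T (suc r , c) →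
    ∀ k → DeletesCorner id T (r , suc c) (slide (suc (suc k)) T r c)
  slide-rightIntoCorner {r} {c} corner below∉T k with v , right ← shape⇒entry T (proj₁ corner) =
    let next = setEntry-state (initialState T-nonEmpty) (λ (_ , right∉T , _) → right∉T (proj₁ corner)) (r , suc c) v
    in subst (DeletesCorner id T (r , suc c))
             (sym (trans (slide-right (suc k) T r c right (∉shape⇒entry≡nothing T below∉T)) (slide-atCorner k next corner)))
             (dropLastOfRow-deletesCorner next corner)

  slide-downIntoCorner : ∀ {r c} → Corner (Shape T) (suc r , c) → ¬ Shape T (r , suc c) →
    ∀ k → DeletesCorner id T (suc r , c) (slide (suc (suc k)) T r c)
  slide-downIntoCorner {r} {c} corner right∉T k with v , below ← shape⇒entry T (proj₁ corner) =
    let next = setEntry-state (initialState T-nonEmpty) (λ (_ , _ , below∉T) → below∉T (proj₁ corner)) (suc r , c) v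
    in subst (DeletesCorner id T (suc r , c))
             (sym (trans (slide-down (suc k) T r c (∉shape⇒entry≡nothing T right∉T) below) (slide-atCorner k next corner)))
             (dropLastOfRow-deletesCorner next corner)

-- Entries of standard Young tableaux

at⇒∈ : ∀ xs {i v} → at xs i ≡ just v → v ∈ xs
at⇒∈ (x ∷ xs) {zero}  refl = here refl
at⇒∈ (x ∷ xs) {suc i} eq   = there (at⇒∈ xs eq)

∈⇒at : ∀ xs {v} → v ∈ xs → ∃[ i ] at xs i ≡ just v
∈⇒at (x ∷ xs) (here refl) = zero , refl
∈⇒at (x ∷ xs) (there v∈xs) = let i , eq = ∈⇒at xs v∈xs in suc i , eq

at-injective : ∀ xs {i j v} → Unique xs → at xs i ≡ just v → at xs j ≡ just v → i ≡ j
at-injective (x ∷ xs) {zero}  {zero}  _                 _    _  = refl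
at-injective (x ∷ xs) {zero}  {suc j} (x∉xs ∷ _)        refl eq = contradiction refl (lookup x∉xs (at⇒∈ xs eq))
at-injective (x ∷ xs) {suc i} {zero}  (x∉xs ∷ _)        eq refl = contradiction refl (lookup x∉xs (at⇒∈ xs eq))
at-injective (x ∷ xs) {suc i} {suc j} (_ ∷ xs-unique) eq eq′ = cong suc (at-injective xs xs-unique eq eq′)

unique-++ : ∀ xs {ys : List ℕ} → Unique (xs ++ ys) → Unique xs × Unique ys × (∀ {v} → v ∈ xs → ¬ v ∈ ys)
unique-++ []       ys-unique = [] , ys-unique , λ ()
unique-++ (x ∷ xs) (x∉ ∷ rest) with unique-++ xs rest | ++⁻ xs x∉
... | xs-unique , ys-unique , disjoint | x∉xs , x∉ys = (x∉xs ∷ xs-unique) , ys-unique , λ where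
  (here refl) v∈ys → lookup x∉ys v∈ys refl
  (there v∈xs) → disjoint v∈xs

entry⇒∈concat : ∀ t {q v} → t [ q ] ≡ just v → v ∈ concat t
entry⇒∈concat (row ∷ rs) {zero , c}  eq = ∈-++⁺ˡ (at⇒∈ row eq)
entry⇒∈concat (row ∷ rs) {suc r , c} eq = ∈-++⁺ʳ row (entry⇒∈concat rs eq)

∈concat⇒entry : ∀ t {v} → v ∈ concat t → ∃[ q ] t [ q ] ≡ just v
∈concat⇒entry (row ∷ rs) v∈ with ∈-++⁻ row v∈
... | inj₁ v∈row = let c , eq = ∈⇒at row v∈row in (0 , c) , eq
... | inj₂ v∈rs  = let (r , c) , eq = ∈concat⇒entry rs v∈rs in (suc r , c) , eq

entry-injective : ∀ t {q q′ v} → Unique (concat t) → t [ q ] ≡ just v → t [ q′ ] ≡ just v → q ≡ q′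
entry-injective (row ∷ rs) {zero , c} {zero , c′} u eq eq′ =
  cong (0 ,_) (at-injective row (proj₁ (unique-++ row u)) eq eq′)
entry-injective (row ∷ rs) {zero , c} {suc r′ , c′} u eq eq′ =
  contradiction (entry⇒∈concat rs eq′) (proj₂ (proj₂ (unique-++ row u)) (at⇒∈ row eq))
entry-injective (row ∷ rs) {suc r , c} {zero , c′} u eq eq′ =
  contradiction (entry⇒∈concat rs eq) (proj₂ (proj₂ (unique-++ row u)) (at⇒∈ row eq′))
entry-injective (row ∷ rs) {suc r , c} {suc r′ , c′} u eq eq′ =
  cong (λ (a , b) → suc a , b) (entry-injective rs (proj₁ (proj₂ (unique-++ row u))) eq eq′)

∈oneTo⇒bounds : ∀ {n v} → v ∈ oneTo n → 1 ≤ v × v ≤ n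
∈oneTo⇒bounds v∈ with ∈-map⁻ suc v∈
... | _ , i∈upTo , refl = s≤s z≤n , ∈-upTo⁻ i∈upTo

bounds⇒∈oneTo : ∀ {n v} → 1 ≤ v → v ≤ n → v ∈ oneTo n
bounds⇒∈oneTo {v = suc v} _ v<n = ∈-map⁺ suc (∈-upTo⁺ v<n)

rowLen-antitone : ∀ t {r r′} → Linked _≥_ (map length t) → r ≤ r′ → rowLen t r′ ≤ rowLen t r
rowLen-antitone t {zero} {zero} _ _ = ≤-refl
rowLen-antitone [] _ _ = z≤n
rowLen-antitone (row ∷ []) {zero} {suc r′} _ _ = z≤n
rowLen-antitone (row ∷ row′ ∷ rs) {zero} {suc r′} (row′≤row ∷ linked) _ =
  ≤-trans (rowLen-antitone (row′ ∷ rs) {zero} {r′} linked z≤n) row′≤row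
rowLen-antitone (row ∷ rs) {suc r} {suc r′} linked (s≤s r≤r′) = rowLen-antitone rs (Linked.tail linked) r≤r′

posInRow-sound : ∀ xs m {i} → posInRow xs m ≡ just i → at xs i ≡ just m
posInRow-sound (x ∷ xs) m eq with x ≡ᵇ m in x≡m
posInRow-sound (x ∷ xs) m refl | true = cong just (≡ᵇ⇒≡ x m (subst Bool.T (sym x≡m) tt))
... | false with posInRow xs m in found
posInRow-sound (x ∷ xs) m refl | false | just i = posInRow-sound xs m found

posInRow-complete : ∀ xs m {i} → at xs i ≡ just m → ∃[ j ] posInRow xs m ≡ just j
posInRow-complete (x ∷ xs) m eq with x ≡ᵇ m in x≡m
... | true = zero , refl
... | false with posInRow xs m in found
...   | just j = suc j , refl
posInRow-complete (x ∷ xs) m {zero} refl | false | nothing = ⊥-elim (subst Bool.T x≡m (≡⇒≡ᵇ m m refl))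
posInRow-complete (x ∷ xs) m {suc i} eq | false | nothing with posInRow-complete xs m eq
... | _ , found′ = contradiction (trans (sym found) found′) λ ()

posOf-sound : ∀ t m {q} → posOf t m ≡ just q → t [ q ] ≡ just m
posOf-sound (row ∷ rs) m eq with posInRow row m in inRow
posOf-sound (row ∷ rs) m refl | just c = posInRow-sound row m inRow
... | nothing with posOf rs m in below
posOf-sound (row ∷ rs) m refl | nothing | just (r , c) = posOf-sound rs m below

posOf-complete : ∀ t m {q} → t [ q ] ≡ just m → ∃[ q′ ] posOf t m ≡ just q′
posOf-complete (row ∷ rs) m eq with posInRow row m in inRow
... | just c = (0 , c) , refl
... | nothing with posOf rs m in below
...   | just (r , c) = (suc r , c) , refl
posOf-complete (row ∷ rs) m {zero , c} eq | nothing | nothing with posInRow-complete row m eq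
... | _ , inRow′ = contradiction (trans (sym inRow) inRow′) λ ()
posOf-complete (row ∷ rs) m {suc r , c} eq | nothing | nothing with posOf-complete rs m eq
... | _ , below′ = contradiction (trans (sym below) below′) λ ()

minus-unfold : ∀ t m {r c} → posOf t m ≡ just (r , c) → minus t m ≡ renumber m (slide (numCells t) t r c)
minus-unfold t m found rewrite found = refl

module SYT {n : ℕ} {T : Tableau} (syt : IsSYT n T) where
  open IsSYT syt

  entries-unique : Unique (concat T)
  entries-unique = Unique-resp-↭ (setoid ℕ) (↭⇒↭ₛ (↭-sym entries)) (map⁺ suc-injective (upTo⁺ n))

  entry-bounds : ∀ {q v} → T [ q ] ≡ just v → 1 ≤ v × v ≤ n
  entry-bounds eq = ∈oneTo⇒bounds (∈-resp-↭ entries (entry⇒∈concat T eq))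

  cellOf : ∀ {v} → 1 ≤ v → v ≤ n → ∃[ q ] T [ q ] ≡ just v
  cellOf 1≤v v≤n = ∈concat⇒entry T (∈-resp-↭ (↭-sym entries) (bounds⇒∈oneTo 1≤v v≤n))

  cell-unique : ∀ {q q′ v} → T [ q ] ≡ just v → T [ q′ ] ≡ just v → q ≡ q′
  cell-unique = entry-injective T entries-unique

  value-unique : ∀ {q v v′} → T [ q ] ≡ just v → T [ q ] ≡ just v′ → v ≡ v′
  value-unique eq eq′ = just-injective (trans (sym eq) eq′)

  shape-downClosed : DownClosed (Shape T)
  shape-downClosed {r , c} {r′ , c′} (r≤r′ , c≤c′) c′<len =
    ≤-<-trans c≤c′ (≤-trans c′<len (rowLen-antitone T shape r≤r′))

  shape-covered : CornerCovered (Shape T)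
  shape-covered = cornerCovered (shape? T) (numCells T) (row+column<numCells T rowsNonEmpty)

  shape-atLeast : AtLeast n (Shape T)
  shape-atLeast = cell , cell-injective , λ i → entry⇒shape T (proj₂ (cellOf′ i))
    where
    cellOf′ : (i : Fin n) → ∃[ q ] T [ q ] ≡ just (suc (toℕ i))
    cellOf′ i = cellOf (s≤s z≤n) (toℕ<n i)
    cell : Fin n → Cell
    cell = proj₁ ∘ cellOf′
    cell-injective : Injective _≡_ _≡_ cell
    cell-injective {i} {j} same = toℕ-injective (suc-injective (value-unique (proj₂ (cellOf′ i))
                                                  (subst (λ q → T [ q ] ≡ _) (sym same) (proj₂ (cellOf′ j)))))

  max-corner : ∀ {p} → T [ p ] ≡ just n → Corner (Shape T) p
  max-corner {r , c} max = entry⇒shape T max , right∉T , below∉T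
    where
    right∉T : ¬ Shape T (r , suc c)
    right∉T right∈T with y , right ← shape⇒entry T right∈T =
      <⇒≱ (rowIncr r c n y max right) (proj₂ (entry-bounds right))
    below∉T : ¬ Shape T (suc r , c)
    below∉T below∈T with y , below ← shape⇒entry T below∈T =
      <⇒≱ (colIncr r c n y max below) (proj₂ (entry-bounds below))

  minus-at : ∀ {r c m} → T [ r , c ] ≡ just m → minus T m ≡ renumber m (slide (numCells T) T r c)
  minus-at {r} {c} {m} eq with (r′ , c′) , found ← posOf-complete T m {r , c} eq
    with refl ← cell-unique (posOf-sound T m found) eq = minus-unfold T m found

  minus-viaSlide : ∀ {r c e m} → T [ r , c ] ≡ just m → DeletesCorner id T e (slide (numCells T) T r c) →
    DeletesCorner (Maybe.map (renum m)) T e (minus T m)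
  minus-viaSlide {m = m} eq del = subst (DeletesCorner _ T _) (sym (minus-at eq)) (renumber-deletesCorner m del)

  minus-deletesSomeCorner : ∀ {q m} → T [ q ] ≡ just m → ∃[ e ] DeletesCorner (Maybe.map (renum m)) T e (minus T m)
  minus-deletesSomeCorner {r , c} eq =
    let e , del = slide-deletesCorner rowsNonEmpty (numCells T) T r c (initialState rowsNonEmpty)
                    (entry⇒shape T eq) (m≤m+n (numCells T) (r + c))
    in e , minus-viaSlide eq del

  minus-corner : ∀ {k w} → Corner (Shape T) k → T [ k ] ≡ just w → DeletesCorner (Maybe.map (renum w)) T k (minus T w)
  minus-corner {r , c} corner eq with numCells T in cells | row+column<numCells T rowsNonEmpty (proj₁ corner)
  ... | suc k | _ = minus-viaSlide eq (subst (λ N → DeletesCorner id T (r , c) (slide N T r c)) (sym cells)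
                      (slide-fromCorner rowsNonEmpty corner k))

  minus-rightIntoCorner : ∀ {r c w} → Corner (Shape T) (r , suc c) → ¬ Shape T (suc r , c) → T [ r , c ] ≡ just w →
    DeletesCorner (Maybe.map (renum w)) T (r , suc c) (minus T w)
  minus-rightIntoCorner {r} {c} corner below∉T eq
    with numCells T in cells | subst (_< numCells T) (+-suc r c) (row+column<numCells T rowsNonEmpty (proj₁ corner))
  ... | suc zero | s≤s ()
  ... | suc (suc k) | _ = minus-viaSlide eq (subst (λ N → DeletesCorner id T (r , suc c) (slide N T r c)) (sym cells)
                            (slide-rightIntoCorner rowsNonEmpty corner below∉T k))

  minus-downIntoCorner : ∀ {r c w} → Corner (Shape T) (suc r , c) → ¬ Shape T (r , suc c) → T [ r , c ] ≡ just w →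
    DeletesCorner (Maybe.map (renum w)) T (suc r , c) (minus T w)
  minus-downIntoCorner {r} {c} corner right∉T eq
    with numCells T in cells | row+column<numCells T rowsNonEmpty (proj₁ corner)
  ... | suc zero | s≤s ()
  ... | suc (suc k) | _ = minus-viaSlide eq (subst (λ N → DeletesCorner id T (suc r , c) (slide N T r c)) (sym cells)
                            (slide-downIntoCorner rowsNonEmpty corner right∉T k))

  minus-entryOfMax : ∀ {p m} → T [ p ] ≡ just n → 1 ≤ m → m ≤ n → Shape (minus T m) p →
    minus T m [ p ] ≡ just (n ∸ 1)
  minus-entryOfMax {p} {m} max 1≤m m≤n p∈minus
    with q , eq ← cellOf 1≤m m≤n
    with e , del ← minus-deletesSomeCorner eq
    with p≢e ← proj₂ (proj₁ (DeletesCorner.shape del) p p∈minus)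
    with m ≟ n
  ... | yes refl = contradiction (deletesCorner-unique (minus-corner (max-corner max) max) del) p≢e
  ... | no m≢n = begin
    minus T m [ p ]               ≡⟨ DeletesCorner.corners del p (max-corner max) p≢e ⟩
    Maybe.map (renum m) (T [ p ]) ≡⟨ cong (Maybe.map (renum m)) max ⟩
    just (renum m n)              ≡⟨ cong just (renum-> (≤∧≢⇒< m≤n m≢n)) ⟩
    just (n ∸ 1)                  ∎
    where open ≡-Reasoning

-- Tableaux with the same 1-minors

module _ {n : ℕ} {T T′ : Tableau} (syt : IsSYT n T) (syt′ : IsSYT n T′)
         (minors⊆ : IsOneMinor n T ⊆′ IsOneMinor n T′) where

  private
    module A = SYT syt
    module B = SYT syt′

  cornerDeck : ∀ k → Corner (Shape T) k → ∃[ e ] Corner (Shape T′) e × (Shape T ∖ k) ≐′ (Shape T′ ∖ e)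
  cornerDeck k k-corner
    with w , T[k] ← shape⇒entry T (proj₁ k-corner)
    with 1≤w , w≤n ← A.entry-bounds T[k]
    with m′ , 1≤m′ , m′≤n , same-minor ← minors⊆ (minus T w) (w , 1≤w , w≤n , refl)
    with e , del′ ← B.minus-deletesSomeCorner (proj₂ (B.cellOf 1≤m′ m′≤n))
    = e , DeletesCorner.corner del′
        , (λ q → proj₁ shape′ q ∘ shapeOf-minor q ∘ proj₂ shape q)
        , (λ q → proj₁ shape q ∘ shapeOf-minor′ q ∘ proj₂ shape′ q)
    where
    shape = DeletesCorner.shape (A.minus-corner k-corner T[k])
    shape′ = DeletesCorner.shape del′
    shapeOf-minor : Shape (minus T w) ⊆′ Shape (minus T′ m′)
    shapeOf-minor q = subst (λ u → Shape u q) (sym same-minor)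
    shapeOf-minor′ : Shape (minus T′ m′) ⊆′ Shape (minus T w)
    shapeOf-minor′ q = subst (λ u → Shape u q) same-minor

  minor-entryOfMax : ∀ {p′ m} → T′ [ p′ ] ≡ just n → 1 ≤ m → m ≤ n → Shape (minus T m) p′ →
    minus T m [ p′ ] ≡ just (n ∸ 1)
  minor-entryOfMax {p′} {m} max′ 1≤m m≤n
    with m′ , 1≤m′ , m′≤n , same-minor ← minors⊆ (minus T m) (m , 1≤m , m≤n , refl) =
    subst (λ u → Shape u p′ → u [ p′ ] ≡ just (n ∸ 1)) same-minor (B.minus-entryOfMax max′ 1≤m′ m′≤n)

  module _ (same-shape : Shape T ≐′ Shape T′) {p p′ : Cell}
           (max : T [ p ] ≡ just n) (max′ : T′ [ p′ ] ≡ just n) (p≢p′ : p ≢ p′) where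

    p-corner : Corner (Shape T) p
    p-corner = A.max-corner max

    p′-corner : Corner (Shape T) p′
    p′-corner = corner-≐ (swap same-shape) (B.max-corner max′)

    p′-holds-n-1 : T [ p′ ] ≡ just (n ∸ 1)
    p′-holds-n-1 with v , T[p′] ← shape⇒entry T (proj₁ p′-corner) = begin
      T [ p′ ]                       ≡⟨ T[p′] ⟩
      just v                         ≡⟨ cong just (sym (renum-≤ (proj₂ (A.entry-bounds T[p′])))) ⟩
      Maybe.map (renum n) (just v)   ≡⟨ cong (Maybe.map (renum n)) (sym T[p′]) ⟩
      Maybe.map (renum n) (T [ p′ ]) ≡⟨ sym (DeletesCorner.corners del p′ p′-corner (p≢p′ ∘ sym)) ⟩
      minus T n [ p′ ]               ≡⟨ minor-entryOfMax max′ (proj₁ (A.entry-bounds max)) ≤-refl p′∈minus ⟩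
      just (n ∸ 1)                   ∎
      where
      open ≡-Reasoning
      del = A.minus-corner p-corner max
      p′∈minus = proj₂ (DeletesCorner.shape del) p′ (proj₁ p′-corner , p≢p′ ∘ sym)

    -- Otherwise p′ survives in minus T w, where it holds n - 1 as in every minor of T′, but also
    -- the renumbering of n - 1, which is n - 2.
    minus-deletes-p′ : ∀ {q w e} → T [ q ] ≡ just w → w < n ∸ 1 →
      DeletesCorner (Maybe.map (renum w)) T e (minus T w) → e ≡ p′
    minus-deletes-p′ {q} {w} {e} T[q] w<n-1 del with e ≟ᶜ p′
    ... | yes e≡p′ = e≡p′
    ... | no e≢p′ = contradiction (just-injective (begin
      just (n ∸ 1)                    ≡⟨ sym (minor-entryOfMax max′ 1≤w w≤n p′∈minus) ⟩
      minus T w [ p′ ]                ≡⟨ DeletesCorner.corners del p′ p′-corner (e≢p′ ∘ sym) ⟩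
      Maybe.map (renum w) (T [ p′ ])  ≡⟨ cong (Maybe.map (renum w)) p′-holds-n-1 ⟩
      just (renum w (n ∸ 1))          ≡⟨ cong just (renum-> w<n-1) ⟩
      just (n ∸ 1 ∸ 1)                ∎)) (≢-pred w<n-1)
      where
      open ≡-Reasoning
      1≤w = proj₁ (A.entry-bounds T[q])
      w≤n = proj₂ (A.entry-bounds T[q])
      p′∈minus = proj₂ (DeletesCorner.shape del) p′ (proj₁ p′-corner , e≢p′ ∘ sym)
      ≢-pred : ∀ {x} → w < x → x ≢ x ∸ 1
      ≢-pred {suc x} _ = 1+n≢n

    entry<n-1 : ∀ {q w} → T [ q ] ≡ just w → q ≢ p → q ≢ p′ → w < n ∸ 1
    entry<n-1 {q} {w} T[q] q≢p q≢p′ = ≤∧≢⇒< (<⇒≤∸1 (≤∧≢⇒< (proj₂ (A.entry-bounds T[q])) w≢n)) w≢n-1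
      where
      w≢n : w ≢ n
      w≢n refl = q≢p (A.cell-unique T[q] max)
      w≢n-1 : w ≢ n ∸ 1
      w≢n-1 refl = q≢p′ (A.cell-unique T[q] p′-holds-n-1)
      <⇒≤∸1 : ∀ {x} → w < x → w ≤ x ∸ 1
      <⇒≤∸1 {suc x} (s≤s w≤x) = w≤x

    corners-p-p′ : ∀ k → Corner (Shape T) k → k ≡ p ⊎ k ≡ p′
    corners-p-p′ k k-corner with k ≟ᶜ p | k ≟ᶜ p′
    ... | yes k≡p | _ = inj₁ k≡p
    ... | no _ | yes k≡p′ = inj₂ k≡p′
    ... | no k≢p | no k≢p′ with w , T[k] ← shape⇒entry T (proj₁ k-corner) =
      contradiction (minus-deletes-p′ T[k] (entry<n-1 T[k] k≢p k≢p′) (A.minus-corner k-corner T[k])) k≢p′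

    p-flanked : Flanked (Shape T) p
    p-flanked = lowerLeft ∘ cong (proj₁ p ,_) , upperRight ∘ cong (_, proj₂ p)
      where
      lowerLeft : ∀ {r c} → p ≡ (r , suc c) → Shape T (suc r , c)
      lowerLeft {r} {c} refl with shape? T (suc r , c)
      ... | yes below∈T = below∈T
      ... | no below∉T with w , T[q] ← shape⇒entry T (A.shape-downClosed (≤-refl , n≤1+n c) (proj₁ p-corner)) =
        contradiction (minus-deletes-p′ T[q] (entry<n-1 T[q] (λ ()) q≢p′)
                         (A.minus-rightIntoCorner p-corner below∉T T[q])) p≢p′
        where
        q≢p′ : (r , c) ≢ p′
        q≢p′ refl = proj₁ (proj₂ p′-corner) (proj₁ p-corner)
      upperRight : ∀ {r c} → p ≡ (suc r , c) → Shape T (r , suc c)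
      upperRight {r} {c} refl with shape? T (r , suc c)
      ... | yes right∈T = right∈T
      ... | no right∉T with w , T[q] ← shape⇒entry T (A.shape-downClosed (n≤1+n r , ≤-refl) (proj₁ p-corner)) =
        contradiction (minus-deletes-p′ T[q] (entry<n-1 T[q] (λ ()) q≢p′)
                         (A.minus-downIntoCorner p-corner right∉T T[q])) p≢p′
        where
        q≢p′ : (r , c) ≢ p′
        q≢p′ refl = proj₂ (proj₂ p′-corner) (proj₁ p-corner)

maxCell-unique : ∀ {n T T′ p p′} → 4 ≤ n → IsSYT n T → IsSYT n T′ →
  (∀ S → IsOneMinor n T S ⇔ IsOneMinor n T′ S) → T [ p ] ≡ just n → T′ [ p′ ] ≡ just n → p ≡ p′
maxCell-unique {n} {T} {T′} {p@(r , _)} {p′@(r′ , _)} 4≤n syt syt′ same-minors max max′ with p ≟ᶜ p′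
... | yes p≡p′ = p≡p′
... | no p≢p′ =
  contradiction (atLeast⇒≤length hook (atLeast-≤ {C = Shape T} 4≤n A.shape-atLeast) T⊆hook) (<-irrefl refl)
  where
  module A = SYT syt
  module B = SYT syt′
  hook : List Cell
  hook = (0 , 0) ∷ (0 , 1) ∷ (1 , 0) ∷ []
  minors⊆ : IsOneMinor n T ⊆′ IsOneMinor n T′
  minors⊆ S = Equivalence.to (same-minors S)
  minors⊇ : IsOneMinor n T′ ⊆′ IsOneMinor n T
  minors⊇ S = Equivalence.from (same-minors S)
  same-shape : Shape T ≐′ Shape T′
  same-shape = deck⇒≐ A.shape-downClosed B.shape-downClosed A.shape-covered B.shape-covered
                 (atLeast-≤ {C = Shape T} (≤-trans (n≤1+n 3) 4≤n) A.shape-atLeast)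
                 (cornerDeck syt syt′ minors⊆) (cornerDeck syt′ syt minors⊇)
  sole : ∀ k → Corner (Shape T) k → k ≡ p ⊎ k ≡ p′
  sole = corners-p-p′ syt syt′ minors⊆ same-shape max max′ p≢p′
  corner : Corner (Shape T) p
  corner = A.max-corner max
  corner′ : Corner (Shape T) p′
  corner′ = p′-corner syt syt′ minors⊆ same-shape max max′ p≢p′
  flanked : Flanked (Shape T) p
  flanked = p-flanked syt syt′ minors⊆ same-shape max max′ p≢p′
  flanked′ : Flanked (Shape T) p′
  flanked′ = flanked-≐ (swap same-shape) (p-flanked syt′ syt minors⊇ (swap same-shape) max′ max (p≢p′ ∘ sym))
  T⊆hook : ∀ q → Shape T q → q ∈ hook
  T⊆hook with <-cmp r r′
  ... | tri< r<r′ _ _ = twoFlankedCorners⊆ A.shape-downClosed A.shape-covered r<r′ corner corner′ sole flanked flanked′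
  ... | tri> _ _ r′<r = twoFlankedCorners⊆ A.shape-downClosed A.shape-covered r′<r corner′ corner
                          (Data.Sum.swap ∘₂ sole) flanked′ flanked
  ... | tri≈ _ refl _ = contradiction (cong (r ,_) (corner-column-unique A.shape-downClosed corner corner′)) p≢p′

mainTheorem2 : ∀ (n : ℕ) → 4 ≤ n → ∀ (T T′ : Tableau) → IsSYT n T → IsSYT n T′
    → (∀ (S : Tableau) → IsOneMinor n T S ⇔ IsOneMinor n T′ S)
    → ∃[ r ] ∃[ c ] (entry T r c ≡ just n × entry T′ r c ≡ just n)
mainTheorem2 n 4≤n T T′ syt syt′ same-minors
  with p , max ← SYT.cellOf syt (≤-trans (s≤s z≤n) 4≤n) ≤-refl
  with p′ , max′ ← SYT.cellOf syt′ (≤-trans (s≤s z≤n) 4≤n) ≤-refl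
  with refl ← maxCell-unique 4≤n syt syt′ same-minors max max′
  = proj₁ p , proj₂ p , max , max′
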